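{- Let $d>1$ be an integer, $q$ a prime power with $q\equiv 1\pmod d$, and $\omega\in\mathbb{F}_q$ a primitive $d$-th root of unity. For $0\le i\le d-1$ let $$A_i(x)=x^{q^{d-1}}+\omega^i x^{q^{d-2}}+\cdots+\omega^{i(d-1)}x,\qquad B_i=\{A_i(a):a\in\mathbb{F}_{q^d}\}.$$ Let $y_i$ be a nonzero element of $B_i$. Then $B_i=\{0\}\cup y_i\mathbb{F}_q^\ast$. -}

module Defs where

open import Level using (Level; _⊔_)
open import Data.Nat as ℕ using (ℕ; zero; suc; _∸_; _<_; _≤_)
open import Data.Nat.Primality using (Prime)
open import Data.Fin using (Fin)
open import Data.Product using (Σ; ∃; _×_)
open import Relation.Nullary using (¬_)
open import Relation.Binary.PropositionalEquality using (_≡_)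
open import Algebra.Bundles using (CommutativeRing; Semiring)
import Algebra.Definitions.RawSemiring as RS

IsPrimePower : ℕ → Set
IsPrimePower q = Σ ℕ λ p → Σ ℕ λ k → Prime p × 1 ≤ k × q ≡ p ℕ.^ k

module _ {c ℓ : Level} (R : CommutativeRing c ℓ) where
  open CommutativeRing R
  open RS (Semiring.rawSemiring semiring) using (_^_)

  record IsField : Set (c ⊔ ℓ) where
    field
      0≉1     : ¬ (0# ≈ 1#)
      inverse : ∀ x → ¬ (x ≈ 0#) → ∃ λ y → x * y ≈ 1#

  HasCard : ℕ → Set (c ⊔ ℓ)
  HasCard N = Σ (Fin N → Carrier) λ e →
    (∀ i j → e i ≈ e j → i ≡ j) × (∀ x → ∃ λ i → e i ≈ x)

  PrimitiveRoot : ℕ → Carrier → Set ℓ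
  PrimitiveRoot d ω = (ω ^ d ≈ 1#) × (∀ k → 0 < k → k < d → ¬ (ω ^ k ≈ 1#))

  sumTo : ℕ → (ℕ → Carrier) → Carrier
  sumTo zero    f = 0#
  sumTo (suc n) f = sumTo n f + f n

  A : (q d : ℕ) → Carrier → ℕ → Carrier → Carrier
  A q d ω i x = sumTo d λ j → (ω ^ (i ℕ.* j)) * (x ^ (q ℕ.^ (d ∸ 1 ∸ j)))

  InB : (q d : ℕ) → Carrier → ℕ → Carrier → Set (c ⊔ ℓ)
  InB q d ω i z = ∃ λ a → A q d ω i a ≈ z

  -- z ∈ F_q, the subfield of fixed points of x ↦ x^q
  InFq : ℕ → Carrier → Set ℓ
  InFq q z = z ^ q ≈ z

module Submission where

-- Every element of B_i is an eigenvector of the Frobenius x ↦ x ^ q for the eigenvalue ω ^ i: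
-- raising A_i(a) to the q-th power shifts its summands cyclically, by additivity of x ↦ x ^ q
-- (the characteristic is p) and a ^ (q ^ d) = a (Fermat in a field with q ^ d elements).
-- Two nonzero eigenvectors for the same nonzero eigenvalue have a Frobenius-fixed ratio,
-- which lies in F_q; conversely A_i is F_q-linear, so B_i is closed under F_q-scaling.

open import Defs
open import Level using (Level)
open import Data.Nat as ℕ using (ℕ; zero; suc; _<_; _∸_; _!; NonZero)
import Data.Nat.Properties as ℕ
open import Data.Nat.Combinatorics using (_C_; nCk≡n!/k![n-k]!; k![n∸k]!∣n!; nCn≡1)
open import Data.Nat.DivMod using (m/n*n≡m)
open import Data.Nat.Divisibility using (_∣_; divides; m∣m*n; ∣⇒≤)
open import Data.Nat.Primality using (Prime; euclidsLemma; prime⇒nonTrivial; prime⇒nonZero)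
open import Data.Fin as Fin using (Fin; toℕ; punchIn; inject₁; fromℕ)
import Data.Fin.Properties as Fin
open import Data.Fin.Permutation using (Permutation; permutation; _⟨$⟩ʳ_)
open import Data.Product using (∃; _×_; _,_; proj₁; proj₂)
open import Data.Sum using (_⊎_; inj₁; inj₂)
open import Data.Empty using (⊥-elim)
open import Relation.Nullary using (¬_; yes; no)
open import Relation.Binary.Definitions using (Decidable)
open import Relation.Binary.PropositionalEquality as ≡ using (_≡_; _≢_)
open import Algebra.Bundles using (CommutativeRing; CommutativeSemiring)
import Algebra.Properties.CommutativeMonoid.Sum as CommutativeMonoidSum
import Algebra.Properties.CommutativeSemiring.Binomial as Binomial
import Algebra.Properties.CommutativeSemiring.Exp as CommutativeSemiringExp
import Algebra.Properties.Semiring.Exp as SemiringExp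
import Algebra.Properties.Semiring.Mult as SemiringMult
import Algebra.Properties.Group as GroupProperties
import Algebra.Properties.CommutativeSemigroup as CommutativeSemigroupProperties
import Relation.Binary.Reasoning.Setoid as SetoidReasoning

prime∤! : ∀ {p m} → Prime p → m < p → ¬ (p ∣ m !)
prime∤! {p} {zero} p-prime _ p∣1 = ℕ.<⇒≱ (ℕ.nonTrivial⇒n>1 p {{prime⇒nonTrivial p-prime}}) (∣⇒≤ p∣1)
prime∤! {p} {suc m} p-prime m<p p∣m! with euclidsLemma (suc m) (m !) p-prime p∣m!
... | inj₁ p∣1+m = ℕ.<⇒≱ m<p (∣⇒≤ p∣1+m)
... | inj₂ p∣m! = prime∤! p-prime (ℕ.<-trans (ℕ.n<1+n m) m<p) p∣m!

nCk*[k!*[n∸k]!]≡n! : ∀ {n k} → k ℕ.≤ n → (n C k) ℕ.* (k ! ℕ.* (n ∸ k) !) ≡ n !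
nCk*[k!*[n∸k]!]≡n! {n} {k} k≤n = ≡.trans (≡.cong (ℕ._* (k ! ℕ.* (n ∸ k) !)) (nCk≡n!/k![n-k]! k≤n)) (m/n*n≡m {{_}} (k![n∸k]!∣n! k≤n))

n∣n! : ∀ n .{{_ : NonZero n}} → n ∣ n !
n∣n! (suc n) = m∣m*n (n !)

prime∣pCk : ∀ {p k} → Prime p → 0 < k → k < p → p ∣ p C k
prime∣pCk {p} {k} p-prime 0<k k<p
  with euclidsLemma (p C k) (k ! ℕ.* (p ∸ k) !) p-prime
       (≡.subst (p ∣_) (≡.sym (nCk*[k!*[n∸k]!]≡n! (ℕ.<⇒≤ k<p))) (n∣n! p {{prime⇒nonZero p-prime}}))
... | inj₁ p∣pCk = p∣pCk
... | inj₂ p∣k!*[p∸k]! with euclidsLemma (k !) ((p ∸ k) !) p-prime p∣k!*[p∸k]!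
...   | inj₁ p∣k! = ⊥-elim (prime∤! p-prime k<p p∣k!)
...   | inj₂ p∣[p∸k]! = ⊥-elim (prime∤! p-prime (ℕ.∸-monoʳ-< 0<k (ℕ.<⇒≤ k<p)) p∣[p∸k]!)

module Frobenius {c ℓ} (S : CommutativeSemiring c ℓ) where
  open CommutativeSemiring S
  open SemiringExp semiring
  open SemiringMult semiring renaming (_×_ to _·_)
  open Binomial S
  open CommutativeMonoidSum +-commutativeMonoid using (sum; sum-init-last; sum-cong-≋; sum-replicate; sum-replicate-zero)
  open SetoidReasoning setoid

  ·-zeroʳ : ∀ n → n · 0# ≈ 0#
  ·-zeroʳ n = trans (sym (sum-replicate n)) (sum-replicate-zero n)

  ·1-homo-^ : ∀ p m → (p ℕ.^ m) · 1# ≈ (p · 1#) ^ m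
  ·1-homo-^ p zero = ×-homo-1 1#
  ·1-homo-^ p (suc m) = trans (×1-homo-* p (p ℕ.^ m)) (*-congˡ (·1-homo-^ p m))

  ·1≈0⇒·≈0 : ∀ n {x} → n · 1# ≈ 0# → n · x ≈ 0#
  ·1≈0⇒·≈0 n {x} n·1≈0 = begin
    n · x          ≈⟨ ×-congʳ n (*-identityˡ x) ⟨
    n · (1# * x)   ≈⟨ ×-assoc-* n 1# x ⟨
    (n · 1#) * x   ≈⟨ *-congʳ n·1≈0 ⟩
    0# * x         ≈⟨ zeroˡ x ⟩
    0#             ∎

  freshmansDream : ∀ n .{{_ : NonZero n}} → (∀ k → 0 < k → k < n → (n C k) · 1# ≈ 0#) →
                   ∀ x y → (x + y) ^ n ≈ x ^ n + y ^ n
  freshmansDream (suc r) inner≈0 x y = begin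
    (x + y) ^ n                                     ≈⟨ theorem n x y ⟩
    term Fin.zero + sum (λ k → term (Fin.suc k))    ≈⟨ +-congˡ (sum-init-last (λ k → term (Fin.suc k))) ⟩
    term Fin.zero + (sum inner + term (Fin.suc (fromℕ r)))
      ≈⟨ +-cong first≈y^n (+-cong inner-sum≈0 (last≈x^n (Fin.suc (fromℕ r)) (≡.cong suc (Fin.toℕ-fromℕ r)))) ⟩
    y ^ n + (0# + x ^ n)                            ≈⟨ +-congˡ (+-identityˡ (x ^ n)) ⟩
    y ^ n + x ^ n                                   ≈⟨ +-comm (y ^ n) (x ^ n) ⟩
    x ^ n + y ^ n                                   ∎
    where
    n : ℕ
    n = suc r
    term : Fin (suc n) → Carrier
    term = binomialTerm x y n
    inner : Fin r → Carrier
    inner j = term (Fin.suc (inject₁ j))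
    first≈y^n : term Fin.zero ≈ y ^ n
    first≈y^n = trans (×-homo-1 _) (*-identityˡ (y ^ n))
    last≈x^n : ∀ k → toℕ k ≡ n → term k ≈ x ^ n
    last≈x^n k k≡n = begin
      (n C toℕ k) · (x ^ toℕ k * y ^ (n ∸ toℕ k)) ≈⟨ ×-congˡ (≡.trans (≡.cong (n C_) k≡n) (nCn≡1 n)) ⟩
      1 · (x ^ toℕ k * y ^ (n ∸ toℕ k))          ≈⟨ ×-homo-1 _ ⟩
      x ^ toℕ k * y ^ (n ∸ toℕ k)                ≈⟨ *-cong (^-congʳ x k≡n) (^-congʳ y (≡.trans (≡.cong (n ∸_) k≡n) (ℕ.n∸n≡0 n))) ⟩
      x ^ n * 1#                                 ≈⟨ *-identityʳ (x ^ n) ⟩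
      x ^ n                                      ∎
    inner-sum≈0 : sum inner ≈ 0#
    inner-sum≈0 = trans (sum-cong-≋ {r} λ j → ·1≈0⇒·≈0 (n C toℕ (Fin.suc (inject₁ j))) (inner≈0 _ ℕ.z<s (toℕ-inner<n j))) (sum-replicate-zero r)
      where
      toℕ-inner<n : ∀ j → toℕ (Fin.suc (inject₁ j)) < n
      toℕ-inner<n j = ℕ.s≤s (≡.subst (_< r) (≡.sym (Fin.toℕ-inject₁ j)) (Fin.toℕ<n j))

  module _ {p} (p-prime : Prime p) (p·1≈0 : p · 1# ≈ 0#) where

    frobenius : ∀ x y → (x + y) ^ p ≈ x ^ p + y ^ p
    frobenius = freshmansDream p {{prime⇒nonZero p-prime}} pCk·1≈0
      where
      pCk·1≈0 : ∀ k → 0 < k → k < p → (p C k) · 1# ≈ 0#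
      pCk·1≈0 k 0<k k<p with prime∣pCk p-prime 0<k k<p
      ... | divides m pCk≡m*p = begin
        (p C k) · 1#       ≡⟨ ≡.cong (_· 1#) pCk≡m*p ⟩
        (m ℕ.* p) · 1#     ≈⟨ ×-assocˡ 1# m p ⟨
        m · (p · 1#)       ≈⟨ ×-congʳ m p·1≈0 ⟩
        m · 0#             ≈⟨ ·-zeroʳ m ⟩
        0#                 ∎

    frobenius-^ : ∀ k x y → (x + y) ^ (p ℕ.^ k) ≈ x ^ (p ℕ.^ k) + y ^ (p ℕ.^ k)
    frobenius-^ zero x y = trans (*-identityʳ (x + y)) (sym (+-cong (*-identityʳ x) (*-identityʳ y)))
    frobenius-^ (suc k) x y = begin
      (x + y) ^ (p ℕ.* p ℕ.^ k)                 ≈⟨ ^-assocʳ (x + y) p (p ℕ.^ k) ⟨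
      ((x + y) ^ p) ^ (p ℕ.^ k)                 ≈⟨ ^-congˡ (p ℕ.^ k) (frobenius x y) ⟩
      (x ^ p + y ^ p) ^ (p ℕ.^ k)               ≈⟨ frobenius-^ k (x ^ p) (y ^ p) ⟩
      (x ^ p) ^ (p ℕ.^ k) + (y ^ p) ^ (p ℕ.^ k) ≈⟨ +-cong (^-assocʳ x p _) (^-assocʳ y p _) ⟩
      x ^ (p ℕ.* p ℕ.^ k) + y ^ (p ℕ.* p ℕ.^ k) ∎

module FieldProperties {c ℓ} (K : CommutativeRing c ℓ) (F : IsField K) where
  open CommutativeRing K
  open SemiringExp semiring
  open CommutativeSemiringExp commutativeSemiring using (^-distrib-*)
  open IsField F
  module Π = CommutativeMonoidSum *-commutativeMonoid
  open SetoidReasoning setoid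

  1≉0 : 1# ≉ 0#
  1≉0 1≈0 = 0≉1 (sym 1≈0)

  *-cancelˡ : ∀ {x u v} → x ≉ 0# → x * u ≈ x * v → u ≈ v
  *-cancelˡ {x} {u} {v} x≉0 xu≈xv with inverse x x≉0
  ... | x⁻¹ , xx⁻¹≈1 = begin
    u                ≈⟨ *-identityˡ u ⟨
    1# * u           ≈⟨ *-congʳ (trans (sym xx⁻¹≈1) (*-comm x x⁻¹)) ⟩
    (x⁻¹ * x) * u    ≈⟨ *-assoc x⁻¹ x u ⟩
    x⁻¹ * (x * u)    ≈⟨ *-congˡ xu≈xv ⟩
    x⁻¹ * (x * v)    ≈⟨ *-assoc x⁻¹ x v ⟨
    (x⁻¹ * x) * v    ≈⟨ *-congʳ (trans (*-comm x⁻¹ x) xx⁻¹≈1) ⟩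
    1# * v           ≈⟨ *-identityˡ v ⟩
    v                ∎

  *-≉0 : ∀ {x y} → x ≉ 0# → y ≉ 0# → x * y ≉ 0#
  *-≉0 {x} {y} x≉0 y≉0 xy≈0 = y≉0 (*-cancelˡ x≉0 (trans xy≈0 (sym (zeroʳ x))))

  ^-≉0 : ∀ {x} n → x ≉ 0# → x ^ n ≉ 0#
  ^-≉0 zero    _   = 1≉0
  ^-≉0 (suc n) x≉0 = *-≉0 x≉0 (^-≉0 n x≉0)

  ∏-≉0 : ∀ {n} (v : Fin n → Carrier) → (∀ i → v i ≉ 0#) → Π.sum v ≉ 0#
  ∏-≉0 {zero}  v _   = 1≉0
  ∏-≉0 {suc n} v v≉0 = *-≉0 (v≉0 Fin.zero) (∏-≉0 (λ i → v (Fin.suc i)) (λ i → v≉0 (Fin.suc i)))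

  root-of-unity-≉0 : ∀ {x} n → x ^ suc n ≈ 1# → x ≉ 0#
  root-of-unity-≉0 {x} n x^[1+n]≈1 x≈0 = 1≉0 (begin
    1#          ≈⟨ x^[1+n]≈1 ⟨
    x * x ^ n   ≈⟨ *-congʳ x≈0 ⟩
    0# * x ^ n  ≈⟨ zeroˡ (x ^ n) ⟩
    0#          ∎)

  ^-eigenvector-ratio : ∀ q {u y z} → u ≉ 0# → y ≉ 0# → z ≉ 0# →
                        y ^ q ≈ u * y → z ^ q ≈ u * z →
                        ∃ λ t → t ^ q ≈ t × t ≉ 0# × z ≈ y * t
  ^-eigenvector-ratio q {u} {y} {z} u≉0 y≉0 z≉0 y^q≈uy z^q≈uz with inverse y y≉0
  ... | y⁻¹ , yy⁻¹≈1 = t , t^q≈t , t≉0 , sym yt≈z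
    where
    t : Carrier
    t = z * y⁻¹
    yt≈z : y * t ≈ z
    yt≈z = begin
      y * (z * y⁻¹)   ≈⟨ *-congˡ (*-comm z y⁻¹) ⟩
      y * (y⁻¹ * z)   ≈⟨ *-assoc y y⁻¹ z ⟨
      (y * y⁻¹) * z   ≈⟨ *-congʳ yy⁻¹≈1 ⟩
      1# * z          ≈⟨ *-identityˡ z ⟩
      z               ∎
    t≉0 : t ≉ 0#
    t≉0 t≈0 = z≉0 (trans (sym yt≈z) (trans (*-congˡ t≈0) (zeroʳ y)))
    t^q≈t : t ^ q ≈ t
    t^q≈t = *-cancelˡ (λ y^q≈0 → *-≉0 u≉0 y≉0 (trans (sym y^q≈uy) y^q≈0)) (begin
      y ^ q * t ^ q   ≈⟨ ^-distrib-* y t q ⟨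
      (y * t) ^ q     ≈⟨ ^-congˡ q yt≈z ⟩
      z ^ q           ≈⟨ z^q≈uz ⟩
      u * z           ≈⟨ *-congˡ yt≈z ⟨
      u * (y * t)     ≈⟨ *-assoc u y t ⟨
      (u * y) * t     ≈⟨ *-congʳ y^q≈uy ⟨
      y ^ q * t       ∎)

module FiniteRing {c ℓ} (K : CommutativeRing c ℓ) (N : ℕ) (card : HasCard K N) where
  open CommutativeRing K
  open SemiringMult semiring renaming (_×_ to _·_) using ()
  open CommutativeMonoidSum +-commutativeMonoid using (sum; sum-permute; sum-cong-≋; ∑-distrib-+; sum-replicate)
  open GroupProperties +-group using (identityʳ-unique)
  open SetoidReasoning setoid

  enum : Fin N → Carrier
  enum = proj₁ card

  enum-injective : ∀ i j → enum i ≈ enum j → i ≡ j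
  enum-injective = proj₁ (proj₂ card)

  index : Carrier → Fin N
  index x = proj₁ (proj₂ (proj₂ card) x)

  enum-index : ∀ x → enum (index x) ≈ x
  enum-index x = proj₂ (proj₂ (proj₂ card) x)

  ≈-dec : Decidable _≈_
  ≈-dec x y with index x Fin.≟ index y
  ... | yes ix≡iy = yes (begin
    x              ≈⟨ enum-index x ⟨
    enum (index x) ≡⟨ ≡.cong enum ix≡iy ⟩
    enum (index y) ≈⟨ enum-index y ⟩
    y              ∎)
  ... | no ix≢iy = no λ x≈y → ix≢iy (enum-injective _ _ (trans (enum-index x) (trans x≈y (sym (enum-index y)))))

  module Relabel (g g⁻¹ : Carrier → Carrier)
           (g-cong : ∀ {x y} → x ≈ y → g x ≈ g y) (g⁻¹-cong : ∀ {x y} → x ≈ y → g⁻¹ x ≈ g⁻¹ y)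
           (g∘g⁻¹ : ∀ x → g (g⁻¹ x) ≈ x) (g⁻¹∘g : ∀ x → g⁻¹ (g x) ≈ x) where

    relabel : Permutation N N
    relabel = permutation to from to∘from from∘to
      where
      to from : Fin N → Fin N
      to i = index (g (enum i))
      from i = index (g⁻¹ (enum i))
      to∘from : ∀ i → to (from i) ≡ i
      to∘from i = enum-injective _ _ (begin
        enum (to (from i))        ≈⟨ enum-index _ ⟩
        g (enum (from i))         ≈⟨ g-cong (enum-index _) ⟩
        g (g⁻¹ (enum i))          ≈⟨ g∘g⁻¹ (enum i) ⟩
        enum i                    ∎)
      from∘to : ∀ i → from (to i) ≡ i
      from∘to i = enum-injective _ _ (begin
        enum (from (to i))        ≈⟨ enum-index _ ⟩
        g⁻¹ (enum (to i))         ≈⟨ g⁻¹-cong (enum-index _) ⟩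
        g⁻¹ (g (enum i))          ≈⟨ g⁻¹∘g (enum i) ⟩
        enum i                    ∎)

    enum-relabel : ∀ i → enum (relabel ⟨$⟩ʳ i) ≈ g (enum i)
    enum-relabel i = enum-index (g (enum i))

  -- Translation by 1# permutes the ring, so Σ x ≈ Σ (x + 1#) ≈ Σ x + N · 1#.
  characteristic : N · 1# ≈ 0#
  characteristic = identityʳ-unique (sum enum) (N · 1#) (sym (begin
    sum enum                              ≈⟨ sum-permute enum relabel ⟩
    sum (λ i → enum (relabel ⟨$⟩ʳ i))     ≈⟨ sum-cong-≋ enum-relabel ⟩
    sum (λ i → enum i + 1#)               ≈⟨ ∑-distrib-+ enum (λ _ → 1#) ⟩
    sum enum + sum {N} (λ _ → 1#)         ≈⟨ +-congˡ (sum-replicate N) ⟩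
    sum enum + N · 1#                     ∎))
    where
    open Relabel (_+ 1#) (_- 1#) +-congʳ +-congʳ
      (λ x → trans (+-assoc x (- 1#) 1#) (trans (+-congˡ (-‿inverseˡ 1#)) (+-identityʳ x)))
      (λ x → trans (+-assoc x 1# (- 1#)) (trans (+-congˡ (-‿inverseʳ 1#)) (+-identityʳ x)))

module FiniteField {c ℓ} (K : CommutativeRing c ℓ) (F : IsField K) (N : ℕ) (card : HasCard K N) where
  open CommutativeRing K
  open SemiringExp semiring
  open SemiringMult semiring renaming (_×_ to _·_) using (×-congˡ)
  open Frobenius commutativeSemiring using (·1-homo-^)
  open FieldProperties K F
  open FiniteRing K N card
  open IsField F using (inverse)
  open SetoidReasoning setoid

  ^≈0⇒≈0 : ∀ {x} n → x ^ n ≈ 0# → x ≈ 0#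
  ^≈0⇒≈0 {x} n x^n≈0 with ≈-dec x 0#
  ... | yes x≈0 = x≈0
  ... | no x≉0 = ⊥-elim (^-≉0 n x≉0 x^n≈0)

  p^m≡N⇒p·1≈0 : ∀ p m → p ℕ.^ m ≡ N → p · 1# ≈ 0#
  p^m≡N⇒p·1≈0 p m p^m≡N = ^≈0⇒≈0 m (begin
    (p · 1#) ^ m      ≈⟨ ·1-homo-^ p m ⟨
    (p ℕ.^ m) · 1#    ≈⟨ ×-congˡ p^m≡N ⟩
    N · 1#            ≈⟨ characteristic ⟩
    0#                ∎)

  frobenius-^ : ∀ {p m} → Prime p → p ℕ.^ m ≡ N → ∀ k x y → (x + y) ^ (p ℕ.^ k) ≈ x ^ (p ℕ.^ k) + y ^ (p ℕ.^ k)
  frobenius-^ {p} {m} p-prime p^m≡N = Frobenius.frobenius-^ commutativeSemiring p-prime (p^m≡N⇒p·1≈0 p m p^m≡N)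

  ∏-punctured : ∀ {n a} (i₀ : Fin n) (v : Fin n → Carrier) → v i₀ ≈ 1# → (∀ j → j ≢ i₀ → v j ≈ a) →
                a * Π.sum v ≈ a ^ n
  ∏-punctured {suc n} {a} i₀ v v[i₀]≈1 v≈a = *-congˡ (begin
    Π.sum v                                  ≈⟨ Π.sum-remove {i = i₀} v ⟩
    v i₀ * Π.sum (λ j → v (punchIn i₀ j))    ≈⟨ *-cong v[i₀]≈1 (Π.sum-cong-≋ λ j → v≈a _ (Fin.punchInᵢ≢i i₀ j)) ⟩
    1# * Π.sum {n} (λ _ → a)                 ≈⟨ *-identityˡ _ ⟩
    Π.sum {n} (λ _ → a)                      ≈⟨ Π.sum-replicate n ⟩
    a ^ n                                    ∎)

  module _ {a} (a≉0 : a ≉ 0#) where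
    private
      nonzeroPart : Carrier → Carrier
      nonzeroPart x with ≈-dec x 0#
      ... | yes _ = 1#
      ... | no _  = x

      factor : Carrier → Carrier
      factor x with ≈-dec x 0#
      ... | yes _ = 1#
      ... | no _  = a

      nonzeroPart-cong : ∀ {x y} → x ≈ y → nonzeroPart x ≈ nonzeroPart y
      nonzeroPart-cong {x} {y} x≈y with ≈-dec x 0# | ≈-dec y 0#
      ... | yes _   | yes _   = refl
      ... | yes x≈0 | no y≉0  = ⊥-elim (y≉0 (trans (sym x≈y) x≈0))
      ... | no x≉0  | yes y≈0 = ⊥-elim (x≉0 (trans x≈y y≈0))
      ... | no _    | no _    = x≈y

      nonzeroPart-≉0 : ∀ x → nonzeroPart x ≉ 0#
      nonzeroPart-≉0 x with ≈-dec x 0#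
      ... | yes _   = 1≉0
      ... | no x≉0  = x≉0

      nonzeroPart-scale : ∀ x → nonzeroPart (a * x) ≈ factor x * nonzeroPart x
      nonzeroPart-scale x with ≈-dec x 0# | ≈-dec (a * x) 0#
      ... | yes _   | yes _    = sym (*-identityˡ 1#)
      ... | yes x≈0 | no ax≉0  = ⊥-elim (ax≉0 (trans (*-congˡ x≈0) (zeroʳ a)))
      ... | no x≉0  | yes ax≈0 = ⊥-elim (*-≉0 a≉0 x≉0 ax≈0)
      ... | no _    | no _     = refl

      factor-0 : ∀ {x} → x ≈ 0# → factor x ≈ 1#
      factor-0 {x} x≈0 with ≈-dec x 0#
      ... | yes _   = refl
      ... | no x≉0  = ⊥-elim (x≉0 x≈0)

      factor-≉0 : ∀ {x} → x ≉ 0# → factor x ≈ a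
      factor-≉0 {x} x≉0 with ≈-dec x 0#
      ... | yes x≈0 = ⊥-elim (x≉0 x≈0)
      ... | no _    = refl

      -- Multiplication by a permutes the ring; with 0 replaced by 1 the product P of all
      -- elements is a unit, so P ≈ ∏ factor * P cancels.
      ∏-factor≈1 : Π.sum (λ i → factor (enum i)) ≈ 1#
      ∏-factor≈1 = *-cancelˡ (∏-≉0 _ (λ i → nonzeroPart-≉0 (enum i))) (begin
        P * ∏factor                                        ≈⟨ *-comm P ∏factor ⟩
        ∏factor * P                                        ≈⟨ Π.∑-distrib-+ (λ i → factor (enum i)) (λ i → nonzeroPart (enum i)) ⟨
        Π.sum (λ i → factor (enum i) * nonzeroPart (enum i)) ≈⟨ Π.sum-cong-≋ (λ i → trans (nonzeroPart-cong (enum-relabel i)) (nonzeroPart-scale (enum i))) ⟨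
        Π.sum (λ i → nonzeroPart (enum (relabel ⟨$⟩ʳ i)))  ≈⟨ Π.sum-permute (λ i → nonzeroPart (enum i)) relabel ⟨
        P                                                  ≈⟨ *-identityʳ P ⟨
        P * 1#                                             ∎)
        where
        P ∏factor : Carrier
        P = Π.sum (λ i → nonzeroPart (enum i))
        ∏factor = Π.sum (λ i → factor (enum i))
        a⁻¹ : Carrier
        a⁻¹ = proj₁ (inverse a a≉0)
        aa⁻¹≈1 : a * a⁻¹ ≈ 1#
        aa⁻¹≈1 = proj₂ (inverse a a≉0)
        open Relabel (a *_) (a⁻¹ *_) *-congˡ *-congˡ
          (λ x → trans (sym (*-assoc a a⁻¹ x)) (trans (*-congʳ aa⁻¹≈1) (*-identityˡ x)))
          (λ x → trans (sym (*-assoc a⁻¹ a x)) (trans (*-congʳ (trans (*-comm a⁻¹ a) aa⁻¹≈1)) (*-identityˡ x)))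

    fermat-≉0 : a ^ N ≈ a
    fermat-≉0 = begin
      a ^ N                                 ≈⟨ ∏-punctured (index 0#) (λ i → factor (enum i)) (factor-0 (enum-index 0#)) factor-≉0-off ⟨
      a * Π.sum (λ i → factor (enum i))     ≈⟨ *-congˡ ∏-factor≈1 ⟩
      a * 1#                                ≈⟨ *-identityʳ a ⟩
      a                                     ∎
      where
      factor-≉0-off : ∀ j → j ≢ index 0# → factor (enum j) ≈ a
      factor-≉0-off j j≢i₀ = factor-≉0 λ e[j]≈0 → j≢i₀ (enum-injective j (index 0#) (trans e[j]≈0 (sym (enum-index 0#))))

  fermat : ∀ x → x ^ N ≈ x
  fermat x with ≈-dec x 0#
  ... | no x≉0  = fermat-≉0 x≉0
  ... | yes x≈0 = trans (^-congˡ N x≈0) (trans (0^-inhabited (index 0#)) (sym x≈0))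
    where
    0^-inhabited : ∀ {n} → Fin n → 0# ^ n ≈ 0#
    0^-inhabited {suc n} _ = zeroˡ (0# ^ n)

module SumTo {c ℓ} (K : CommutativeRing c ℓ) where
  open CommutativeRing K

  sumTo-cong : ∀ n {f g : ℕ → Carrier} → (∀ j → j < n → f j ≈ g j) → sumTo K n f ≈ sumTo K n g
  sumTo-cong zero    _   = refl
  sumTo-cong (suc n) f≈g = +-cong (sumTo-cong n λ j j<n → f≈g j (ℕ.m<n⇒m<1+n j<n)) (f≈g n (ℕ.n<1+n n))

  sumTo-suc : ∀ n (f : ℕ → Carrier) → sumTo K (suc n) f ≈ f 0 + sumTo K n (λ j → f (suc j))
  sumTo-suc zero    f = +-comm 0# (f 0)
  sumTo-suc (suc n) f = trans (+-congʳ (sumTo-suc n f)) (+-assoc _ _ _)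

  *-distribˡ-sumTo : ∀ n t (f : ℕ → Carrier) → t * sumTo K n f ≈ sumTo K n (λ j → t * f j)
  *-distribˡ-sumTo zero    t f = zeroʳ t
  *-distribˡ-sumTo (suc n) t f = trans (distribˡ t _ _) (+-congʳ (*-distribˡ-sumTo n t f))

  sumTo-homo : (φ : Carrier → Carrier) → (∀ x y → φ (x + y) ≈ φ x + φ y) → φ 0# ≈ 0# →
               ∀ n f → φ (sumTo K n f) ≈ sumTo K n (λ j → φ (f j))
  sumTo-homo φ φ-+ φ-0 zero    f = φ-0
  sumTo-homo φ φ-+ φ-0 (suc n) f = trans (φ-+ _ _) (+-congʳ (sumTo-homo φ φ-+ φ-0 n f))

module TwistedTrace {c ℓ} (K : CommutativeRing c ℓ) (q n : ℕ) (ω : CommutativeRing.Carrier K) (i : ℕ) where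
  open CommutativeRing K
  open SemiringExp semiring
  open CommutativeSemiringExp commutativeSemiring using (^-distrib-*)
  open SumTo K
  open CommutativeSemigroupProperties *-commutativeSemigroup using (x∙yz≈y∙xz)
  open GroupProperties +-group using (identityʳ-unique)
  open SetoidReasoning setoid

  d : ℕ
  d = suc n

  term : Carrier → ℕ → Carrier
  term x j = ω ^ (i ℕ.* j) * x ^ (q ℕ.^ (n ∸ j))

  InFq-^ : ∀ {t} m → InFq K q t → InFq K q (t ^ m)
  InFq-^ {t} m t^q≈t = begin
    (t ^ m) ^ q   ≈⟨ ^-assocʳ t m q ⟩
    t ^ (m ℕ.* q) ≈⟨ ^-congʳ t (ℕ.*-comm m q) ⟩
    t ^ (q ℕ.* m) ≈⟨ ^-assocʳ t q m ⟨
    (t ^ q) ^ m   ≈⟨ ^-congˡ m t^q≈t ⟩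
    t ^ m         ∎

  InFq⇒^q^m≈id : ∀ {t} m → InFq K q t → t ^ (q ℕ.^ m) ≈ t
  InFq⇒^q^m≈id {t} zero    _      = *-identityʳ t
  InFq⇒^q^m≈id {t} (suc m) t^q≈t = begin
    t ^ (q ℕ.* q ℕ.^ m)  ≈⟨ ^-assocʳ t q (q ℕ.^ m) ⟨
    (t ^ q) ^ (q ℕ.^ m)  ≈⟨ ^-congˡ (q ℕ.^ m) t^q≈t ⟩
    t ^ (q ℕ.^ m)        ≈⟨ InFq⇒^q^m≈id m t^q≈t ⟩
    t                    ∎

  A-scale : ∀ {t} a → InFq K q t → A K q d ω i (t * a) ≈ t * A K q d ω i a
  A-scale {t} a t^q≈t = trans (sumTo-cong d λ j _ → term-scale j) (sym (*-distribˡ-sumTo d t (term a)))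
    where
    term-scale : ∀ j → term (t * a) j ≈ t * term a j
    term-scale j = begin
      ω ^ (i ℕ.* j) * (t * a) ^ (q ℕ.^ (n ∸ j))                     ≈⟨ *-congˡ (^-distrib-* t a (q ℕ.^ (n ∸ j))) ⟩
      ω ^ (i ℕ.* j) * (t ^ (q ℕ.^ (n ∸ j)) * a ^ (q ℕ.^ (n ∸ j)))   ≈⟨ *-congˡ (*-congʳ (InFq⇒^q^m≈id (n ∸ j) t^q≈t)) ⟩
      ω ^ (i ℕ.* j) * (t * a ^ (q ℕ.^ (n ∸ j)))                     ≈⟨ x∙yz≈y∙xz _ t _ ⟩
      t * term a j                                                  ∎

  InB-resp : ∀ {w z} → w ≈ z → InB K q d ω i w → InB K q d ω i z
  InB-resp w≈z (a , Aa≈w) = a , trans Aa≈w w≈z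

  InB-scale : ∀ {t w} → InFq K q t → InB K q d ω i w → InB K q d ω i (t * w)
  InB-scale {t} t∈Fq (a , Aa≈w) = t * a , trans (A-scale a t∈Fq) (*-congˡ Aa≈w)

  0∈Fq : (∀ x y → (x + y) ^ q ≈ x ^ q + y ^ q) → InFq K q 0#
  0∈Fq frobenius = identityʳ-unique (0# ^ q) (0# ^ q) (sym (trans (^-congˡ q (sym (+-identityʳ 0#))) (frobenius 0# 0#)))

  module _ (frobenius : ∀ x y → (x + y) ^ q ≈ x ^ q + y ^ q) (fermat : ∀ x → x ^ (q ℕ.^ d) ≈ x)
           (ω∈Fq : InFq K q ω) (ω^d≈1 : ω ^ d ≈ 1#) where

    -- Raising to the q-th power shifts the summands: term (j+1) of A(x)^q is ω^i times term j
    -- of A(x), and term 0 is x ^ (q ^ d) = x, which is ω^i times the last term since ω^(i d) = 1.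
    A-^q : ∀ x → A K q d ω i x ^ q ≈ ω ^ i * A K q d ω i x
    A-^q x = begin
      A K q d ω i x ^ q                                  ≈⟨ sumTo-homo (_^ q) frobenius (0∈Fq frobenius) d (term x) ⟩
      sumTo K d (λ j → term x j ^ q)                     ≈⟨ sumTo-suc n _ ⟩
      term x 0 ^ q + sumTo K n (λ j → term x (suc j) ^ q) ≈⟨ +-cong first≈x (sumTo-cong n shifted) ⟩
      x + sumTo K n (λ j → ω ^ i * term x j)             ≈⟨ +-cong (sym last) (sym (*-distribˡ-sumTo n (ω ^ i) (term x))) ⟩
      ω ^ i * term x n + ω ^ i * sumTo K n (term x)      ≈⟨ +-comm _ _ ⟩
      ω ^ i * sumTo K n (term x) + ω ^ i * term x n      ≈⟨ distribˡ (ω ^ i) _ _ ⟨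
      ω ^ i * A K q d ω i x                              ∎
      where
      term^q : ∀ j → term x j ^ q ≈ ω ^ (i ℕ.* j) * x ^ (q ℕ.^ (n ∸ j) ℕ.* q)
      term^q j = trans (^-distrib-* (ω ^ (i ℕ.* j)) _ q) (*-cong (InFq-^ (i ℕ.* j) ω∈Fq) (^-assocʳ x (q ℕ.^ (n ∸ j)) q))
      first≈x : term x 0 ^ q ≈ x
      first≈x = begin
        term x 0 ^ q                                 ≈⟨ term^q 0 ⟩
        ω ^ (i ℕ.* 0) * x ^ (q ℕ.^ n ℕ.* q)          ≈⟨ *-cong (^-congʳ ω (ℕ.*-zeroʳ i)) (^-congʳ x (ℕ.*-comm (q ℕ.^ n) q)) ⟩
        1# * x ^ (q ℕ.^ d)                           ≈⟨ *-identityˡ _ ⟩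
        x ^ (q ℕ.^ d)                                ≈⟨ fermat x ⟩
        x                                            ∎
      shifted : ∀ j → j < n → term x (suc j) ^ q ≈ ω ^ i * term x j
      shifted j j<n = begin
        term x (suc j) ^ q                                   ≈⟨ term^q (suc j) ⟩
        ω ^ (i ℕ.* suc j) * x ^ (q ℕ.^ (n ∸ suc j) ℕ.* q)
          ≈⟨ *-cong (trans (^-congʳ ω (ℕ.*-suc i j)) (^-homo-* ω i (i ℕ.* j)))
                    (^-congʳ x (≡.trans (ℕ.*-comm _ q) (≡.cong (q ℕ.^_) (≡.sym (ℕ.+-∸-assoc 1 j<n))))) ⟩
        (ω ^ i * ω ^ (i ℕ.* j)) * x ^ (q ℕ.^ (n ∸ j))        ≈⟨ *-assoc _ _ _ ⟩
        ω ^ i * term x j                                     ∎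
      ω^[id]≈1 : ω ^ (i ℕ.* d) ≈ 1#
      ω^[id]≈1 = begin
        ω ^ (i ℕ.* d)  ≈⟨ ^-congʳ ω (ℕ.*-comm i d) ⟩
        ω ^ (d ℕ.* i)  ≈⟨ ^-assocʳ ω d i ⟨
        (ω ^ d) ^ i    ≈⟨ ^-congˡ i ω^d≈1 ⟩
        1# ^ i         ≈⟨ 1^ i ⟩
        1#             ∎
        where
        1^ : ∀ m → 1# ^ m ≈ 1#
        1^ zero    = refl
        1^ (suc m) = trans (*-identityˡ _) (1^ m)
      last : ω ^ i * term x n ≈ x
      last = begin
        ω ^ i * (ω ^ (i ℕ.* n) * x ^ (q ℕ.^ (n ∸ n)))   ≈⟨ *-assoc _ _ _ ⟨
        (ω ^ i * ω ^ (i ℕ.* n)) * x ^ (q ℕ.^ (n ∸ n))   ≈⟨ *-cong (^-homo-* ω i _) (^-congʳ x (≡.cong (q ℕ.^_) (≡.sym (ℕ.n∸n≡0 n)))) ⟨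
        ω ^ (i ℕ.+ i ℕ.* n) * x ^ 1                     ≈⟨ *-cong (trans (^-congʳ ω (≡.sym (ℕ.*-suc i n))) ω^[id]≈1) (*-identityʳ x) ⟩
        1# * x                                          ≈⟨ *-identityˡ x ⟩
        x                                               ∎

    InB⇒^q≈ω^i* : ∀ {w} → InB K q d ω i w → w ^ q ≈ ω ^ i * w
    InB⇒^q≈ω^i* (a , Aa≈w) = trans (^-congˡ q (sym Aa≈w)) (trans (A-^q a) (*-congˡ Aa≈w))

open import Data.Nat using (_^_)

lemma6p2 : ∀ {c ℓ : Level} (d q : ℕ) → 1 < d → IsPrimePower q → d ∣ (q ∸ 1) →
    (K : CommutativeRing c ℓ) → IsField K → HasCard K (q ^ d) →
    (ω : CommutativeRing.Carrier K) → InFq K q ω → PrimitiveRoot K d ω →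
    (i : ℕ) → i < d →
    (y : CommutativeRing.Carrier K) → InB K q d ω i y → ¬ (CommutativeRing._≈_ K y (CommutativeRing.0# K)) →
    (z : CommutativeRing.Carrier K) →
    (InB K q d ω i z →
      (CommutativeRing._≈_ K z (CommutativeRing.0# K) ⊎
        ∃ λ t → InFq K q t × ¬ (CommutativeRing._≈_ K t (CommutativeRing.0# K)) × CommutativeRing._≈_ K z (CommutativeRing._*_ K y t)))
    × ((CommutativeRing._≈_ K z (CommutativeRing.0# K) ⊎
        ∃ λ t → InFq K q t × ¬ (CommutativeRing._≈_ K t (CommutativeRing.0# K)) × CommutativeRing._≈_ K z (CommutativeRing._*_ K y t))
      → InB K q d ω i z)
lemma6p2 zero _ ()
lemma6p2 (suc n) _ _ (p , k , p-prime , _ , ≡.refl) _ K F card ω ω∈Fq (ω^d≈1 , _) i _ y y∈B y≉0 z = B⇒scalar , scalar⇒B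
  where
  open CommutativeRing K using (_≈_; 0#; _+_; _*_; sym; trans; *-comm; zeroˡ; semiring)
  open SemiringExp semiring using () renaming (_^_ to _^ᴷ_)
  open FieldProperties K F using (^-eigenvector-ratio; ^-≉0; root-of-unity-≉0)
  open FiniteRing K _ card using (≈-dec)
  open FiniteField K F _ card using (fermat; frobenius-^)
  open TwistedTrace K (p ^ k) n ω i

  frobenius-q : ∀ x y → (x + y) ^ᴷ (p ^ k) ≈ x ^ᴷ (p ^ k) + y ^ᴷ (p ^ k)
  frobenius-q = frobenius-^ {m = k ℕ.* suc n} p-prime (≡.sym (ℕ.^-*-assoc p k (suc n))) k
  twisted : ∀ {w} → InB K (p ^ k) (suc n) ω i w → w ^ᴷ (p ^ k) ≈ ω ^ᴷ i * w
  twisted = InB⇒^q≈ω^i* frobenius-q fermat ω∈Fq ω^d≈1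

  B⇒scalar : InB K (p ^ k) (suc n) ω i z → z ≈ 0# ⊎ ∃ λ t → InFq K (p ^ k) t × ¬ (t ≈ 0#) × z ≈ y * t
  B⇒scalar z∈B with ≈-dec z 0#
  ... | yes z≈0 = inj₁ z≈0
  ... | no z≉0  = inj₂ (^-eigenvector-ratio (p ^ k) (^-≉0 i (root-of-unity-≉0 n ω^d≈1)) y≉0 z≉0 (twisted y∈B) (twisted z∈B))

  scalar⇒B : z ≈ 0# ⊎ (∃ λ t → InFq K (p ^ k) t × ¬ (t ≈ 0#) × z ≈ y * t) → InB K (p ^ k) (suc n) ω i z
  scalar⇒B (inj₁ z≈0) = InB-resp (trans (zeroˡ y) (sym z≈0)) (InB-scale (0∈Fq frobenius-q) y∈B)
  scalar⇒B (inj₂ (t , t∈Fq , _ , z≈yt)) = InB-resp (trans (*-comm t y) (sym z≈yt)) (InB-scale t∈Fq y∈B)
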